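{- Let $Q$ be a complete quiver with at least two frozen vertices, and let $j,k$ be distinct mutable vertices such that $j$ is cycle-preserving for $Q$ and $k$ is cycle-preserving for $\mu_j(Q)$. If $j$ is neither red nor green in $Q$, then $j$ is red or green in $\mu_k(\mu_j(Q))$.
   Context: Quiver: finite directed graph without loops or oriented 2-cycles, vertices partitioned into mutable and frozen, arrows between frozen vertices ignored. Mutation $\mu_j$: for each path $i\xrightarrow{a}j\xrightarrow{b}k$ add $ab$ arrows $i\to k$, reverse arrows at $j$, cancel 2-cycles. Complete: at least one arrow between each pair of vertices at least one mutable. A 3-vertex quiver is an oriented cycle if it has at most one frozen vertex and is not acyclic. $j$ is cycle-preserving for $Q$ if whenever $Q|_{ijk}$ is an oriented 3-cycle containing $j$, so is $\mu_j(Q)|_{ijk}$. A mutable vertex adjacent to a frozen vertex is red (green) if all arrows between it and frozen vertices point toward (away from) it. -}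

module Defs where

open import Data.Nat using (ℕ; _+_; _*_; _∸_; _<_)
open import Data.Fin using (Fin; _≟_)
open import Data.Bool using (Bool; true; false; if_then_else_; _∨_)
open import Data.Product using (_×_; ∃; ∃-syntax)
open import Data.Sum using (_⊎_)
open import Relation.Nullary using (¬_; does)
open import Relation.Binary.PropositionalEquality using (_≡_; _≢_)

-- A quiver on vertex set Fin n: arr i k = number of arrows i → k,
-- frozen i = true iff i is frozen.
record Quiver (n : ℕ) : Set where
  field
    arr    : Fin n → Fin n → ℕ
    frozen : Fin n → Bool
open Quiver public

Mutable : ∀ {n} → Quiver n → Fin n → Set
Mutable Q i = frozen Q i ≡ false

Frozen : ∀ {n} → Quiver n → Fin n → Set
Frozen Q i = frozen Q i ≡ true

IsQuiver : ∀ {n} → Quiver n → Set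
IsQuiver Q = (∀ i → arr Q i i ≡ 0) × (∀ i k → arr Q i k ≡ 0 ⊎ arr Q k i ≡ 0)

-- Mutation at j: for i → j → k (i, k ≠ j) add (#i→j)(#j→k) arrows i → k,
-- reverse all arrows at j, then cancel 2-cycles (truncated subtraction).
mutate : ∀ {n} → Fin n → Quiver n → Quiver n
mutate {n} j Q = record { arr = a' ; frozen = frozen Q }
  where
  a = arr Q
  a' : Fin n → Fin n → ℕ
  a' i k = if does (i ≟ j) ∨ does (k ≟ j)
             then a k i
             else ((a i k + a i j * a j k) ∸ (a k i + a k j * a j i))

Complete : ∀ {n} → Quiver n → Set
Complete Q = ∀ i k → i ≢ k → (Mutable Q i ⊎ Mutable Q k) →
             (0 < arr Q i k ⊎ 0 < arr Q k i)

AtLeastTwoFrozen : ∀ {n} → Quiver n → Set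
AtLeastTwoFrozen Q = ∃[ f ] ∃[ g ] (f ≢ g × Frozen Q f × Frozen Q g)

AtMostOneFrozen3 : ∀ {n} → Quiver n → Fin n → Fin n → Fin n → Set
AtMostOneFrozen3 Q i j k =
  (Mutable Q i × Mutable Q j) ⊎ (Mutable Q j × Mutable Q k) ⊎ (Mutable Q i × Mutable Q k)

-- Q|_{ijk} (i, j, k distinct) has a directed cycle. Since the restriction has
-- no loops or 2-cycles, a directed cycle is one of the two cyclic orientations.
NotAcyclic3 : ∀ {n} → Quiver n → Fin n → Fin n → Fin n → Set
NotAcyclic3 Q i j k =
  (0 < arr Q i j × 0 < arr Q j k × 0 < arr Q k i) ⊎
  (0 < arr Q i k × 0 < arr Q k j × 0 < arr Q j i)

OrientedCycle : ∀ {n} → Quiver n → Fin n → Fin n → Fin n → Set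
OrientedCycle Q i j k = AtMostOneFrozen3 Q i j k × NotAcyclic3 Q i j k

CyclePreserving : ∀ {n} → Quiver n → Fin n → Set
CyclePreserving Q j = ∀ i k → i ≢ j → k ≢ j → i ≢ k →
  OrientedCycle Q i j k → OrientedCycle (mutate j Q) i j k

AdjacentToFrozen : ∀ {n} → Quiver n → Fin n → Set
AdjacentToFrozen Q j = ∃[ f ] (Frozen Q f × (0 < arr Q j f ⊎ 0 < arr Q f j))

Red : ∀ {n} → Quiver n → Fin n → Set
Red Q j = Mutable Q j × AdjacentToFrozen Q j × (∀ f → Frozen Q f → arr Q j f ≡ 0)

Green : ∀ {n} → Quiver n → Fin n → Set
Green Q j = Mutable Q j × AdjacentToFrozen Q j × (∀ f → Frozen Q f → arr Q f j ≡ 0)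

-- Completeness joins j and k by an arrow; say j → k (the case k → j is dual and makes j green).
-- Then every frozen h sends an arrow to j in μ_k μ_j Q. If j → h in Q, then μ_j reverses it
-- to h → j, and μ_k cannot cancel it, since μ_j Q has no arrow j → h and no path j → k → h.
-- If h → j in Q, then μ_j Q contains the 3-cycle j → h → k → j: the arrow h → k either
-- survives μ_j or, when Q has k → h, is forced by j being cycle-preserving. As k is
-- cycle-preserving for μ_j Q, the triangle stays an oriented cycle in μ_k μ_j Q, whose
-- arrow j → k forces the orientation j → k → h → j.
module Submission where

open import Defs
open import Data.Nat using (ℕ; _+_; _*_; _∸_; _<_)
open import Data.Nat.Properties using (≤-total; m≤n⇒m∸n≡0; n∸n≡0; m≤m+n; <-≤-trans; *-zeroʳ)
open import Data.Fin using (Fin; _≟_)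
open import Data.Bool using (true; false)
open import Data.Product using (_×_; _,_; proj₂)
open import Data.Sum using (_⊎_; inj₁; inj₂; swap)
import Data.Sum as Sum
open import Relation.Nullary using (¬_; Dec; yes; no; does)
open import Relation.Nullary.Decidable using (dec-true; dec-false)
open import Relation.Binary.PropositionalEquality using (_≡_; _≢_; refl; sym; trans; cong; cong₂; subst; ≢-sym)

private
  variable
    n : ℕ

arr-antisym : (Q : Quiver n) → IsQuiver Q → ∀ {i k} → 0 < arr Q i k → arr Q k i ≡ 0
arr-antisym Q (_ , no-2-cycle) {i} {k} i⟶k with no-2-cycle i k
... | inj₂ k∌i = k∌i
... | inj₁ i∌k with () ← subst (0 <_) i∌k i⟶k

frozen≢mutable : (Q : Quiver n) → ∀ {h j} → Frozen Q h → Mutable Q j → h ≢ j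
frozen≢mutable Q fh mj refl with () ← trans (sym fh) mj

∸-either≡0 : ∀ x y → x ∸ y ≡ 0 ⊎ y ∸ x ≡ 0
∸-either≡0 x y with ≤-total x y
... | inj₁ x≤y = inj₁ (m≤n⇒m∸n≡0 x≤y)
... | inj₂ y≤x = inj₂ (m≤n⇒m∸n≡0 y≤x)

factor≡0⇒*≡0 : ∀ {a b} → a ≡ 0 ⊎ b ≡ 0 → a * b ≡ 0
factor≡0⇒*≡0 (inj₁ refl) = refl
factor≡0⇒*≡0 {a} (inj₂ refl) = *-zeroʳ a

module _ (Q : Quiver n) (j : Fin n) where

  mutate-arr-out : ∀ k → arr (mutate j Q) j k ≡ arr Q k j
  mutate-arr-out k rewrite dec-true (j ≟ j) refl = refl

  mutate-arr-in : ∀ i → arr (mutate j Q) i j ≡ arr Q j i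
  mutate-arr-in i rewrite dec-true (j ≟ j) refl with does (i ≟ j)
  ... | true  = refl
  ... | false = refl

  arr+path : Fin n → Fin n → ℕ
  arr+path i k = arr Q i k + arr Q i j * arr Q j k

  mutate-arr-away : ∀ {i k} → i ≢ j → k ≢ j → arr (mutate j Q) i k ≡ arr+path i k ∸ arr+path k i
  mutate-arr-away {i} {k} i≢j k≢j rewrite dec-false (i ≟ j) i≢j | dec-false (k ≟ j) k≢j = refl

  mutate-reverses-in : ∀ {i} → 0 < arr Q i j → 0 < arr (mutate j Q) j i
  mutate-reverses-in {i} = subst (0 <_) (sym (mutate-arr-out i))

  mutate-reverses-out : ∀ {k} → 0 < arr Q j k → 0 < arr (mutate j Q) k j
  mutate-reverses-out {k} = subst (0 <_) (sym (mutate-arr-in k))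

  mutate-preserves-IsQuiver : IsQuiver Q → IsQuiver (mutate j Q)
  mutate-preserves-IsQuiver (no-loop , no-2-cycle) = no-loop′ , no-2-cycle′
    where
    no-loop′ : ∀ i → arr (mutate j Q) i i ≡ 0
    no-loop′ i = cases (i ≟ j)
      where
      cases : Dec (i ≡ j) → arr (mutate j Q) i i ≡ 0
      cases (yes refl) = trans (mutate-arr-out j) (no-loop j)
      cases (no i≢j)   = trans (mutate-arr-away i≢j i≢j) (n∸n≡0 (arr+path i i))

    no-2-cycle′ : ∀ i k → arr (mutate j Q) i k ≡ 0 ⊎ arr (mutate j Q) k i ≡ 0
    no-2-cycle′ i k = cases (i ≟ j) (k ≟ j)
      where
      cases : Dec (i ≡ j) → Dec (k ≡ j) → arr (mutate j Q) i k ≡ 0 ⊎ arr (mutate j Q) k i ≡ 0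
      cases (yes refl) _ rewrite mutate-arr-out k | mutate-arr-in k = swap (no-2-cycle j k)
      cases (no _) (yes refl) rewrite mutate-arr-in i | mutate-arr-out i = swap (no-2-cycle i j)
      cases (no i≢j) (no k≢j) rewrite mutate-arr-away i≢j k≢j | mutate-arr-away k≢j i≢j =
        ∸-either≡0 (arr+path i k) (arr+path k i)

  mutate-keeps-arrow : IsQuiver Q → ∀ {i k} → i ≢ j → k ≢ j →
    (arr Q k j ≡ 0 ⊎ arr Q j i ≡ 0) → 0 < arr Q i k → 0 < arr (mutate j Q) i k
  mutate-keeps-arrow isQ {i} {k} i≢j k≢j no-path i⟶k =
    subst (0 <_) (sym survives) (<-≤-trans i⟶k (m≤m+n (arr Q i k) (arr Q i j * arr Q j k)))
    where
    survives : arr (mutate j Q) i k ≡ arr+path i k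
    survives = trans (mutate-arr-away i≢j k≢j)
      (cong (arr+path i k ∸_) (cong₂ _+_ (arr-antisym Q isQ i⟶k) (factor≡0⇒*≡0 no-path)))

Cycle3 : Quiver n → Fin n → Fin n → Fin n → Set
Cycle3 Q a b c = 0 < arr Q a b × 0 < arr Q b c × 0 < arr Q c a

module _ (Q : Quiver n) (isQ : IsQuiver Q) where

  cycle-along : ∀ a b c → NotAcyclic3 Q a b c → 0 < arr Q a b → Cycle3 Q a b c
  cycle-along _ _ _ (inj₁ cycle) _ = cycle
  cycle-along _ _ _ (inj₂ (_ , _ , b⟶a)) a⟶b with () ← subst (0 <_) (arr-antisym Q isQ a⟶b) b⟶a

  cycle-against : ∀ a b c → NotAcyclic3 Q a b c → 0 < arr Q b a → Cycle3 Q a c b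
  cycle-against _ _ _ (inj₂ cycle) _ = cycle
  cycle-against _ _ _ (inj₁ (a⟶b , _ , _)) b⟶a with () ← subst (0 <_) (arr-antisym Q isQ b⟶a) a⟶b

  frozen-arrows-in⇒Red : ∀ {j f} → Mutable Q j → Frozen Q f →
    (∀ h → Frozen Q h → 0 < arr Q h j) → Red Q j
  frozen-arrows-in⇒Red {f = f} mj ff h⟶j =
    mj , (f , ff , inj₂ (h⟶j f ff)) , λ h fh → arr-antisym Q isQ (h⟶j h fh)

  frozen-arrows-out⇒Green : ∀ {j f} → Mutable Q j → Frozen Q f →
    (∀ h → Frozen Q h → 0 < arr Q j h) → Green Q j
  frozen-arrows-out⇒Green {f = f} mj ff j⟶h =
    mj , (f , ff , inj₁ (j⟶h f ff)) , λ h fh → arr-antisym Q isQ (j⟶h h fh)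

module CyclePreservingPair
  (Q : Quiver n) (isQ : IsQuiver Q) (comp : Complete Q) (j k : Fin n)
  (mj : Mutable Q j) (mk : Mutable Q k) (j≢k : j ≢ k)
  (cpj : CyclePreserving Q j) (cpk : CyclePreserving (mutate j Q) k) where

  B C : Quiver n
  B = mutate j Q
  C = mutate k B

  isQ-B : IsQuiver B
  isQ-B = mutate-preserves-IsQuiver Q j isQ

  isQ-C : IsQuiver C
  isQ-C = mutate-preserves-IsQuiver B k isQ-B

  private
    k≢j : k ≢ j
    k≢j = ≢-sym j≢k

  frozen⟶j : 0 < arr Q j k → ∀ h → Frozen Q h → 0 < arr C h j
  frozen⟶j j⟶k h fh = by-direction (comp j h (≢-sym h≢j) (inj₁ mj))
    where
    h≢j = frozen≢mutable Q fh mj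
    h≢k = frozen≢mutable Q fh mk

    B-k⟶j : 0 < arr B k j
    B-k⟶j = mutate-reverses-out Q j j⟶k

    B-h⟶k : 0 < arr Q h j → 0 < arr B h k
    B-h⟶k h⟶j with comp k h (≢-sym h≢k) (inj₁ mk)
    ... | inj₁ k⟶h =
      let Q-cycle : OrientedCycle Q k j h
          Q-cycle = inj₁ (mk , mj) , inj₂ (k⟶h , h⟶j , j⟶k)
          (_ , _ , h⟶k) = cycle-along B isQ-B k j h (proj₂ (cpj k h k≢j h≢j (≢-sym h≢k) Q-cycle))
                            B-k⟶j
      in h⟶k
    ... | inj₂ h⟶k = mutate-keeps-arrow Q j isQ h≢j k≢j (inj₁ (arr-antisym Q isQ j⟶k)) h⟶k

    by-direction : 0 < arr Q j h ⊎ 0 < arr Q h j → 0 < arr C h j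
    by-direction (inj₁ j⟶h) =
      mutate-keeps-arrow B k isQ-B h≢k j≢k
        (inj₁ (trans (mutate-arr-out Q j k) (arr-antisym Q isQ j⟶k)))
        (mutate-reverses-out Q j j⟶h)
    by-direction (inj₂ h⟶j) =
      let B-cycle : OrientedCycle B j k h
          B-cycle = inj₁ (mj , mk) , inj₂ (mutate-reverses-in Q j h⟶j , B-h⟶k h⟶j , B-k⟶j)
          (_ , _ , h⟶j′) = cycle-along C isQ-C j k h
                             (proj₂ (cpk j h j≢k h≢k (≢-sym h≢j) B-cycle))
                             (mutate-reverses-out B k B-k⟶j)
      in h⟶j′

  j⟶frozen : 0 < arr Q k j → ∀ h → Frozen Q h → 0 < arr C j h
  j⟶frozen k⟶j h fh = by-direction (comp j h (≢-sym h≢j) (inj₁ mj))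
    where
    h≢j = frozen≢mutable Q fh mj
    h≢k = frozen≢mutable Q fh mk

    B-j⟶k : 0 < arr B j k
    B-j⟶k = mutate-reverses-in Q j k⟶j

    B-k⟶h : 0 < arr Q j h → 0 < arr B k h
    B-k⟶h j⟶h with comp k h (≢-sym h≢k) (inj₁ mk)
    ... | inj₁ k⟶h = mutate-keeps-arrow Q j isQ k≢j h≢j (inj₂ (arr-antisym Q isQ k⟶j)) k⟶h
    ... | inj₂ h⟶k =
      let Q-cycle : OrientedCycle Q h j k
          Q-cycle = inj₂ (inj₁ (mj , mk)) , inj₂ (h⟶k , k⟶j , j⟶h)
          (_ , _ , k⟶h) = cycle-along B isQ-B h j k (proj₂ (cpj h k h≢j k≢j h≢k Q-cycle))
                            (mutate-reverses-out Q j j⟶h)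
      in k⟶h

    by-direction : 0 < arr Q j h ⊎ 0 < arr Q h j → 0 < arr C j h
    by-direction (inj₁ j⟶h) =
      let B-cycle : OrientedCycle B j k h
          B-cycle = inj₁ (mj , mk) , inj₁ (B-j⟶k , B-k⟶h j⟶h , mutate-reverses-out Q j j⟶h)
          (j⟶h′ , _ , _) = cycle-against C isQ-C j k h
                             (proj₂ (cpk j h j≢k h≢k (≢-sym h≢j) B-cycle))
                             (mutate-reverses-in B k B-j⟶k)
      in j⟶h′
    by-direction (inj₂ h⟶j) =
      mutate-keeps-arrow B k isQ-B j≢k h≢k
        (inj₂ (trans (mutate-arr-in Q j k) (arr-antisym Q isQ k⟶j)))
        (mutate-reverses-in Q j h⟶j)

-- The proof uses only one frozen vertex and never uses that j is neither red nor green in Q.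
lemma3p16 : {n : ℕ} (Q : Quiver n) (j k : Fin n) →
    IsQuiver Q → Complete Q → AtLeastTwoFrozen Q →
    Mutable Q j → Mutable Q k → j ≢ k →
    CyclePreserving Q j → CyclePreserving (mutate j Q) k →
    ¬ Red Q j → ¬ Green Q j →
    Red (mutate k (mutate j Q)) j ⊎ Green (mutate k (mutate j Q)) j
lemma3p16 Q j k isQ comp (f , _ , _ , ff , _) mj mk j≢k cpj cpk _ _ =
  Sum.map (λ j⟶k → frozen-arrows-in⇒Red C isQ-C mj ff (frozen⟶j j⟶k))
          (λ k⟶j → frozen-arrows-out⇒Green C isQ-C mj ff (j⟶frozen k⟶j))
          (comp j k j≢k (inj₁ mj))
  where
  open CyclePreservingPair Q isQ comp j k mj mk j≢k cpj cpk
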